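{- If $F$ has $n$ vertices and $o(n^2)$ edges, then $\mathrm{cp}(\overline{F})=o(n^2)$. Precisely: for every $\varepsilon>0$ there exist $\eta>0$ and $n_0$ such that every graph $F$ on $n\ge n_0$ vertices with at most $\eta n^2$ edges satisfies $\mathrm{cp}(\overline{F})\le\varepsilon n^2$.
   Context: A clique partition of a graph $G$ is a collection of complete subgraphs of $G$ whose edge sets partition $E(G)$; the clique partition number $\mathrm{cp}(G)$ is the minimum number of cliques in a clique partition of $G$. $\overline{F}$ denotes the complement of the graph $F$ (on the same vertex set).
   Formalization: The parameter ε ranges over the positive rationals, and the constant η is taken in the rationals. -}

module Defs where

open import Data.Nat using (ℕ; _<ᵇ_)
open import Data.Bool using (Bool; true; false; not; T; _∧_)
open import Data.Empty using (⊥-elim)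
open import Data.Fin using (Fin; toℕ; _≟_)
open import Data.Fin.Subset using (Subset; _∈_)
open import Data.List using (List; length; filterᵇ; allFin; concatMap; map)
open import Data.Product using (_×_; _,_; ∃-syntax)
open import Relation.Binary.PropositionalEquality using (_≡_; _≢_; refl; sym; cong)
open import Relation.Nullary using (¬_; yes; no)

record Graph (n : ℕ) : Set where
  field
    Adj    : Fin n → Fin n → Bool
    symm   : ∀ u v → Adj u v ≡ Adj v u
    irrefl : ∀ u → Adj u u ≡ false

open Graph public

module _ {n : ℕ} (G : Graph n) where
  compAdj : Fin n → Fin n → Bool
  compAdj u v with u ≟ v
  ... | yes _ = false
  ... | no _ = not (Adj G u v)

  compSym : ∀ u v → compAdj u v ≡ compAdj v u
  compSym u v with u ≟ v | v ≟ u
  ... | yes _ | yes _ = refl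
  ... | yes p | no q = ⊥-elim (q (sym p))
  ... | no p | yes q = ⊥-elim (p (sym q))
  ... | no _ | no _ = cong not (symm G u v)

  compIrr : ∀ u → compAdj u u ≡ false
  compIrr u with u ≟ u
  ... | yes _ = refl
  ... | no u≢u = ⊥-elim (u≢u refl)

complement : ∀ {n} → Graph n → Graph n
complement G = record { Adj = compAdj G ; symm = compSym G ; irrefl = compIrr G }

edgeCount : ∀ {n} → Graph n → ℕ
edgeCount {n} G = length (filterᵇ (λ p → test p)
  (concatMap (λ u → map (λ v → (u , v)) (allFin n)) (allFin n)))
  where
  test : Fin n × Fin n → Bool
  test (u , v) = (toℕ u <ᵇ toℕ v) ∧ Adj G u v

IsClique : ∀ {n} → Graph n → Subset n → Set
IsClique G C = ∀ u v → u ∈ C → v ∈ C → u ≢ v → T (Adj G u v)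

record CliquePartition {n : ℕ} (G : Graph n) (k : ℕ) : Set where
  field
    clique   : Fin k → Subset n
    isClique : ∀ i → IsClique G (clique i)
    covers   : ∀ u v → T (Adj G u v) → ∃[ i ] (u ∈ clique i × v ∈ clique i)
    unique   : ∀ u v → T (Adj G u v) → ∀ i j →
               u ∈ clique i → v ∈ clique i → u ∈ clique j → v ∈ clique j → i ≡ j

IsCP : ∀ {n} → Graph n → ℕ → Set
IsCP G k = CliquePartition G k × (∀ m → CliquePartition G m → k Data.Nat.≤ m)

-- Write ε = a/D (lowest terms, a ≥ 1) and use p = 8D columns.  The
-- n vertices are placed on a grid [0,p) × [0,M) with M ≈ n/p chosen so that
-- every 0 < d < p is a unit modulo M (M - 1 is a multiple of p!).  The lines
-- row ≡ a + b·col (mod M) then form a partial linear space: two vertices in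
-- different columns lie on exactly one line.  The lines containing no edge of F
-- are cliques of F̄; together with the single edges of F̄ they leave uncovered
-- they partition F̄ into at most  M² + nM + e(F)·p²  cliques, since a line
-- containing an edge of F is determined by that edge, and an uncovered edge
-- is either inside a column or on such a line.  With e(F) ≤ n²/(4Dp²) this is
-- at most n²/D ≤ εn².
module Submission where

open import Defs
open import Data.Nat using (ℕ; zero; suc; NonZero; _≥_)
open import Data.Nat.Divisibility using (_∣_; ∣-trans; m∣m*n; m≤n⇒m!∣n!)
import Data.Nat as Nat

module Counting where

  open import Data.Nat using (_+_; _*_; _≤_; _<_; _≤?_)
  open import Data.Nat.Properties using (≰⇒>; <-irrefl; ≤-<-trans; <-≤-trans)
  open import Data.Fin using (zero; suc)
  open import Data.Fin.Properties using (pigeonhole; <⇒≢)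
  open import Data.List using (List; []; _∷_; length; lookup; map; _++_; concatMap; cartesianProduct; filter; allFin; upTo)
  open import Data.List.Properties using (length-++; length-map; length-tabulate; length-upTo; filter-notAll)
  open import Data.List.Relation.Unary.All using () renaming (lookup to All-lookup)
  open import Data.List.Relation.Unary.AllPairs using (_∷_)
  open import Data.List.Relation.Unary.Any using (index; any?) renaming (map to Any-map)
  open import Data.List.Relation.Unary.Any.Properties using (lookup-index)
  open import Data.List.Relation.Unary.Unique.Propositional using (Unique)
  open import Data.List.Membership.Propositional using (_∈_; find; lose)
  open import Data.List.Membership.Propositional.Properties
    using (∈-lookup; ∈-filter⁺)
  open import Data.Product using (_×_; _,_; proj₁; proj₂; ∃-syntax)
  open import Data.Empty using (⊥-elim)
  open import Relation.Binary.Definitions using (DecidableEquality)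
  open import Relation.Binary.PropositionalEquality
  open import Relation.Nullary using (yes; no; ¬?)

  lookup-injective : ∀ {A : Set} {xs : List A} → Unique xs →
    ∀ i j → lookup xs i ≡ lookup xs j → i ≡ j
  lookup-injective (_ ∷ _) zero zero _ = refl
  lookup-injective (x∉ ∷ _) zero (suc j) eq = ⊥-elim (All-lookup x∉ (∈-lookup j) eq)
  lookup-injective (x∉ ∷ _) (suc i) zero eq = ⊥-elim (All-lookup x∉ (∈-lookup i) (sym eq))
  lookup-injective (_ ∷ u) (suc i) (suc j) eq = cong suc (lookup-injective u i j eq)

  injection-≤ : ∀ {A B : Set} (R : A → B → Set) {xs : List A} {ys : List B} →
    Unique xs →
    (∀ {x} → x ∈ xs → ∃[ y ] (y ∈ ys × R x y)) →
    (∀ {x x' y} → x ∈ xs → x' ∈ xs → R x y → R x' y → x ≡ x') →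
    length xs ≤ length ys
  injection-≤ R {xs} {ys} uniq image injective with length xs ≤? length ys
  ... | yes fits = fits
  ... | no ≰ with pigeonhole (≰⇒> ≰) (λ i → index (proj₁ (proj₂ (image (∈-lookup i)))))
  ... | i , j , i<j , same-index = ⊥-elim (<⇒≢ i<j (lookup-injective uniq i j xi≡xj))
    where
    yi = image (∈-lookup {xs = xs} i)
    yj = image (∈-lookup {xs = xs} j)
    yi≡yj : proj₁ yi ≡ proj₁ yj
    yi≡yj = trans (lookup-index (proj₁ (proj₂ yi)))
              (trans (cong (lookup ys) same-index) (sym (lookup-index (proj₁ (proj₂ yj)))))
    xi≡xj : lookup xs i ≡ lookup xs j
    xi≡xj = injective (∈-lookup i) (∈-lookup j) (proj₂ (proj₂ yi))
              (subst (R (lookup xs j)) (sym yi≡yj) (proj₂ (proj₂ yj)))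

  -- An injective map from a duplicate-free list into a list that is no longer
  -- hits every member of the target: otherwise it would inject into the
  -- strictly shorter list of the remaining targets.
  injection-onto : ∀ {A B : Set} (_≟_ : DecidableEquality B) (f : A → B)
    {xs : List A} {ys : List B} → Unique xs → length ys ≤ length xs →
    (∀ {x} → x ∈ xs → f x ∈ ys) →
    (∀ {x x'} → x ∈ xs → x' ∈ xs → f x ≡ f x' → x ≡ x') →
    ∀ {y} → y ∈ ys → ∃[ x ] (x ∈ xs × f x ≡ y)
  injection-onto _≟_ f {xs} {ys} uniq short into injective {y} y∈ys
    with any? (λ x → f x ≟ y) xs
  ... | yes hit = find hit
  ... | no miss = ⊥-elim (<-irrefl refl (<-≤-trans (≤-<-trans long fewer) short))
    where
    others : List _
    others = filter (λ y' → ¬? (y' ≟ y)) ys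
    long : length xs ≤ length others
    long = injection-≤ (λ x y' → f x ≡ y') uniq
      (λ {x} x∈ → f x , ∈-filter⁺ (λ y' → ¬? (y' ≟ y)) (into x∈)
                          (λ fx≡y → miss (lose x∈ fx≡y)) , refl)
      (λ x∈ x'∈ fx≡ fx'≡ → injective x∈ x'∈ (trans fx≡ (sym fx'≡)))
    fewer : length others < length ys
    fewer = filter-notAll (λ y' → ¬? (y' ≟ y)) ys
      (Any-map (λ y≡y' y'≢y → y'≢y (sym y≡y')) y∈ys)

  concatMap-pairs : ∀ {A B : Set} (xs : List A) (ys : List B) →
    concatMap (λ x → map (λ y → (x , y)) ys) xs ≡ cartesianProduct xs ys
  concatMap-pairs [] ys = refl
  concatMap-pairs (x ∷ xs) ys = cong (map (x ,_) ys ++_) (concatMap-pairs xs ys)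

  length-cartesianProduct : ∀ {A B : Set} (xs : List A) (ys : List B) →
    length (cartesianProduct xs ys) ≡ length xs * length ys
  length-cartesianProduct [] ys = refl
  length-cartesianProduct (x ∷ xs) ys =
    trans (length-++ (map (x ,_) ys))
          (cong₂ _+_ (length-map (x ,_) ys) (length-cartesianProduct xs ys))

  length-allFin : ∀ n → length (allFin n) ≡ n
  length-allFin n = length-tabulate {n = n} (λ i → i)

  length-upTo² : ∀ a b → length (cartesianProduct (upTo a) (upTo b)) ≡ a * b
  length-upTo² a b = trans (length-cartesianProduct (upTo a) (upTo b)) (cong₂ _*_ (length-upTo a) (length-upTo b))

module TaggedPartition where

  open import Data.Bool using (T; true; false)
  open import Data.Fin using (Fin)
  open import Data.Fin.Subset using (Subset; _∈_)
  open import Data.Vec using (tabulate)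
  open import Data.Vec.Properties using (lookup⇒[]=; []=⇒lookup; lookup∘tabulate)
  open import Data.List using (List; length; lookup)
  open import Data.List.Relation.Unary.Any using (index)
  open import Data.List.Relation.Unary.Any.Properties using (lookup-index)
  open import Data.List.Relation.Unary.Unique.Propositional using (Unique)
  import Data.List.Membership.Propositional as List
  open import Data.List.Membership.Propositional.Properties using (∈-lookup)
  open import Data.Product using (_×_; _,_; ∃-syntax)
  open import Relation.Binary.PropositionalEquality
  open import Relation.Nullary using (Dec; yes; does)
  open import Relation.Nullary.Decidable using (dec-true)
  open import Level using (0ℓ)
  open import Relation.Unary using (Pred; Decidable)
  open Counting using (lookup-injective)

  toSubset : ∀ {n} {P : Pred (Fin n) 0ℓ} → Decidable P → Subset n
  toSubset P? = tabulate (λ w → does (P? w))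

  ∈-toSubset⁺ : ∀ {n} {P : Pred (Fin n) 0ℓ} (P? : Decidable P) {w} → P w → w ∈ toSubset P?
  ∈-toSubset⁺ P? {w} Pw = lookup⇒[]= w _ (trans (lookup∘tabulate _ w) (dec-true (P? w) Pw))

  ∈-toSubset⁻ : ∀ {n} {P : Pred (Fin n) 0ℓ} (P? : Decidable P) {w} → w ∈ toSubset P? → P w
  ∈-toSubset⁻ P? {w} w∈ = witness (P? w) (trans (sym (lookup∘tabulate _ w)) ([]=⇒lookup w∈))
    where
    witness : ∀ {A : Set} (a? : Dec A) → does a? ≡ true → A
    witness (yes a) _ = a

  adjacent⇒distinct : ∀ {n} (G : Graph n) {u v} → T (Adj G u v) → u ≢ v
  adjacent⇒distinct G {u} adj refl with Adj G u u | irrefl G u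
  adjacent⇒distinct G () refl | false | refl

  module _ {n} (G : Graph n) {Tag : Set} (Member : Tag → Pred (Fin n) 0ℓ)
    (member? : ∀ t → Decidable (Member t)) (tags : List Tag) (distinct : Unique tags)
    (clique : ∀ {t u v} → t List.∈ tags → Member t u → Member t v → u ≢ v → T (Adj G u v))
    (cover : ∀ {u v} → T (Adj G u v) → ∃[ t ] (t List.∈ tags × Member t u × Member t v))
    (once : ∀ {t t' u v} → t List.∈ tags → t' List.∈ tags → u ≢ v →
            Member t u → Member t v → Member t' u → Member t' v → t ≡ t')
    where

    taggedPartition : CliquePartition G (length tags)
    taggedPartition = record
      { clique   = λ i → toSubset (member? (lookup tags i))
      ; isClique = λ i u v u∈ v∈ u≢v →
          clique (∈-lookup i) (∈-toSubset⁻ (member? _) u∈) (∈-toSubset⁻ (member? _) v∈) u≢v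
      ; covers   = covers
      ; unique   = λ u v adj i j ui vi uj vj → lookup-injective distinct i j
          (once (∈-lookup i) (∈-lookup j) (adjacent⇒distinct G adj)
            (∈-toSubset⁻ (member? _) ui) (∈-toSubset⁻ (member? _) vi)
            (∈-toSubset⁻ (member? _) uj) (∈-toSubset⁻ (member? _) vj))
      }
      where
      covers : ∀ u v → T (Adj G u v) →
        ∃[ i ] (u ∈ toSubset (member? (lookup tags i)) × v ∈ toSubset (member? (lookup tags i)))
      covers u v adj with cover adj
      ... | t , t∈ , tu , tv = index t∈ , at tu , at tv
        where
        at : ∀ {w} → Member t w → w ∈ toSubset (member? (lookup tags (index t∈)))
        at tw = ∈-toSubset⁺ (member? _) (subst (λ s → Member s _) (lookup-index t∈) tw)

module Congruence (m : ℕ) where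

  open import Data.Nat using (_+_; _*_; _<_; _%_)
  open import Data.Nat.Properties using (+-comm; *-comm; *-assoc)
  open import Data.Nat.DivMod using (%-distribˡ-+; %-distribˡ-*; [m+kn]%n≡m%n; m<n⇒m%n≡m)
  open import Data.Nat.Divisibility using (divides)
  open import Data.Nat.Tactic.RingSolver using (solve-∀)
  open import Data.Product using (_×_; _,_)
  open import Relation.Binary.PropositionalEquality
  open ≡-Reasoning

  M : ℕ
  M = suc m

  infix 4 _≈_
  _≈_ : ℕ → ℕ → Set
  x ≈ y = x % M ≡ y % M

  +-congʳ : ∀ x y z → x ≈ y → x + z ≈ y + z
  +-congʳ x y z x≈y = begin
    (x + z) % M                 ≡⟨ %-distribˡ-+ x z M ⟩
    (x % M + z % M) % M         ≡⟨ cong (λ r → (r + z % M) % M) x≈y ⟩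
    (y % M + z % M) % M         ≡⟨ %-distribˡ-+ y z M ⟨
    (y + z) % M                 ∎

  *-congʳ : ∀ x y z → x ≈ y → x * z ≈ y * z
  *-congʳ x y z x≈y = begin
    (x * z) % M                 ≡⟨ %-distribˡ-* x z M ⟩
    (x % M * (z % M)) % M       ≡⟨ cong (λ r → (r * (z % M)) % M) x≈y ⟩
    (y % M * (z % M)) % M       ≡⟨ %-distribˡ-* y z M ⟨
    (y * z) % M                 ∎

  +-multiple : ∀ x k → x + k * M ≈ x
  +-multiple x k = [m+kn]%n≡m%n x k M

  -- Addition cancels: add z * m to both sides, which turns + z into + z * M.
  +-cancelʳ : ∀ x y z → x + z ≈ y + z → x ≈ y
  +-cancelʳ x y z eq = begin
    x % M                       ≡⟨ +-multiple x z ⟨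
    (x + z * M) % M             ≡⟨ cong (_% M) (shift x z m) ⟩
    (x + z + z * m) % M         ≡⟨ +-congʳ (x + z) (y + z) (z * m) eq ⟩
    (y + z + z * m) % M         ≡⟨ cong (_% M) (shift y z m) ⟨
    (y + z * M) % M             ≡⟨ +-multiple y z ⟩
    y % M                       ∎
    where
    shift : ∀ w z m → w + z * suc m ≡ w + z + z * m
    shift = solve-∀

  -- Multiplication by m, which is -1 modulo M, cancels.
  *-cancel-m : ∀ x y → x * m ≈ y * m → x ≈ y
  *-cancel-m x y eq = begin
    x % M                       ≡⟨ +-multiple x y ⟨
    (x + y * M) % M             ≡⟨ cong (_% M) (swap x y m) ⟩
    (y * m + (x + y)) % M       ≡⟨ sym (+-congʳ (x * m) (y * m) (x + y) eq) ⟩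
    (x * m + (x + y)) % M       ≡⟨ cong (_% M) (trans (cong (x * m +_) (+-comm x y)) (sym (swap y x m))) ⟩
    (y + x * M) % M             ≡⟨ +-multiple y x ⟩
    y % M                       ∎
    where
    swap : ∀ u v m → u + v * suc m ≡ v * m + (u + v)
    swap = solve-∀

  ≈⇒≡ : ∀ {x y} → x < M → y < M → x ≈ y → x ≡ y
  ≈⇒≡ x<M y<M eq = trans (sym (m<n⇒m%n≡m x<M)) (trans eq (m<n⇒m%n≡m y<M))

  -- Rigidity of affine maps x ↦ a + b·x modulo M: if d divides m (so d is a
  -- unit modulo M, with inverse -m/d), two such maps with coefficients below M
  -- that agree at x and at x + d have the same coefficients.
  rigid : ∀ {a b a' b'} x {d} → d ∣ m → a < M → b < M → a' < M → b' < M →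
    a + b * x ≈ a' + b' * x → a + b * (x + d) ≈ a' + b' * (x + d) → a ≡ a' × b ≡ b'
  rigid {a} {b} {a'} {b'} x {d} (divides e m≡ed) a<M b<M a'<M b'<M at-x at-x+d =
    ≈⇒≡ a<M a'<M (+-cancelʳ a a' (b' * x) (subst (λ c → a + c * x ≈ a' + b' * x) b≡b' at-x)) , b≡b'
    where
    split : ∀ u v x d → u + v * (x + d) ≡ u + v * x + v * d
    split = solve-∀
    times-m : ∀ v → v * d * e ≡ v * m
    times-m v = trans (*-assoc v d e) (cong (v *_) (trans (*-comm d e) (sym m≡ed)))
    bd≈b'd : b * d ≈ b' * d
    bd≈b'd = +-cancelʳ (b * d) (b' * d) (a' + b' * x) (begin
      (b * d + (a' + b' * x)) % M   ≡⟨ cong (_% M) (+-comm (b * d) _) ⟩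
      (a' + b' * x + b * d) % M     ≡⟨ +-congʳ (a + b * x) (a' + b' * x) (b * d) at-x ⟨
      (a + b * x + b * d) % M       ≡⟨ cong (_% M) (split a b x d) ⟨
      (a + b * (x + d)) % M         ≡⟨ at-x+d ⟩
      (a' + b' * (x + d)) % M       ≡⟨ cong (_% M) (trans (split a' b' x d) (+-comm _ (b' * d))) ⟩
      (b' * d + (a' + b' * x)) % M  ∎)
    b≡b' : b ≡ b'
    b≡b' = ≈⇒≡ b<M b'<M (*-cancel-m b b' (begin
      (b * m) % M                   ≡⟨ cong (_% M) (times-m b) ⟨
      (b * d * e) % M               ≡⟨ *-congʳ (b * d) (b' * d) e bd≈b'd ⟩
      (b' * d * e) % M              ≡⟨ cong (_% M) (times-m b') ⟩
      (b' * m) % M                  ∎))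

-- Vertex w of an n-vertex graph is placed at the point
-- (col w , row w) = (w mod p , w div p) of the grid [0,p) × [0,M), M = 1 + m.
-- A line is a pair (a , b) ∈ [0,M)², passing through the points with
-- row ≡ a + b·col (mod M).  When every 0 < d < p divides m, these lines form a
-- partial linear space: two vertices in different columns lie on exactly one
-- common line, and a line meets each column at most once.
module Grid (n p m : ℕ) .{{_ : NonZero p}}
  (units : ∀ {d} → 0 Nat.< d → d Nat.< p → d ∣ m) (n≤pM : n Nat.≤ p Nat.* suc m) where

  open import Data.Nat using (_+_; _*_; _<_; _≤_; _%_; _/_; _≟_)
  open import Data.Nat.Properties
    using (<-cmp; *-comm; m<n⇒0<n∸m; ≤-<-trans; <-≤-trans; m∸n≤m; m+[n∸m]≡n; <⇒≤; ≤-reflexive)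
  open import Data.Nat.DivMod using (m%n<n; m<n*o⇒m/o<n; m≡m%n+[m/n]*n)
  open import Data.Fin using (Fin; toℕ)
  open import Data.Fin.Properties using (toℕ-injective; toℕ<n)
  open import Data.List using (List; length; allFin; upTo; cartesianProduct)
  open import Data.List.Relation.Unary.Unique.Propositional using (Unique)
  import Data.List.Relation.Unary.Unique.Propositional.Properties as Unique
  open import Data.List.Membership.Propositional using (_∈_)
  open import Data.List.Membership.Propositional.Properties
    using (∈-allFin; ∈-upTo⁺; ∈-cartesianProduct⁺)
  open import Data.Product using (_×_; _,_; proj₁; proj₂; ∃-syntax)
  open import Data.Product.Properties using (≡-dec)
  open import Data.Empty using (⊥-elim)
  open import Relation.Binary using (tri<; tri≈; tri>)
  open import Relation.Binary.PropositionalEquality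
  open import Relation.Nullary using (yes; no)
  open import Relation.Unary using (Decidable)
  open Congruence m
  open Counting using (injection-onto; length-cartesianProduct; length-allFin; length-upTo²)
  open ≡-Reasoning

  col row : Fin n → ℕ
  col w = toℕ w % p
  row w = toℕ w / p

  col<p : ∀ w → col w < p
  col<p w = m%n<n (toℕ w) p

  row<M : ∀ w → row w < M
  row<M w = m<n*o⇒m/o<n {toℕ w} {M} {p} (<-≤-trans (toℕ<n w) (subst (n ≤_) (*-comm p M) n≤pM))

  position-injective : ∀ {u v} → col u ≡ col v → row u ≡ row v → u ≡ v
  position-injective {u} {v} c r = toℕ-injective (begin
    toℕ u                   ≡⟨ m≡m%n+[m/n]*n (toℕ u) p ⟩
    col u + row u * p       ≡⟨ cong₂ (λ i j → i + j * p) c r ⟩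
    col v + row v * p       ≡⟨ m≡m%n+[m/n]*n (toℕ v) p ⟨
    toℕ v                   ∎)

  Line : Set
  Line = Fin M × Fin M

  lines : List Line
  lines = cartesianProduct (allFin M) (allFin M)

  lines-unique : Unique lines
  lines-unique = Unique.cartesianProduct⁺ (Unique.allFin⁺ M) (Unique.allFin⁺ M)

  ∈-lines : ∀ L → L ∈ lines
  ∈-lines (a , b) = ∈-cartesianProduct⁺ (∈-allFin a) (∈-allFin b)

  #lines : length lines ≡ M * M
  #lines = trans (length-cartesianProduct (allFin M) (allFin M))
                 (cong₂ _*_ (length-allFin M) (length-allFin M))

  height : Line → ℕ → ℕ
  height (a , b) x = (toℕ a + toℕ b * x) % M

  OnLine : Line → Fin n → Set
  OnLine L w = height L (col w) ≡ row w

  onLine? : ∀ L → Decidable (OnLine L)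
  onLine? L w = height L (col w) ≟ row w

  -- Rigidity in the form used below: lines with equal heights at columns
  -- x < y < p coincide, since y - x divides m.
  agree-ordered : ∀ {L L' x y} → x < y → y < p →
    height L x ≡ height L' x → height L y ≡ height L' y → L ≡ L'
  agree-ordered {a , b} {a' , b'} {x} {y} x<y y<p hx hy
    with rigid x (units (m<n⇒0<n∸m x<y) (≤-<-trans (m∸n≤m y x) y<p))
           (toℕ<n a) (toℕ<n b) (toℕ<n a') (toℕ<n b') hx
           (subst (λ z → (toℕ a + toℕ b * z) % M ≡ (toℕ a' + toℕ b' * z) % M)
                  (sym (m+[n∸m]≡n (<⇒≤ x<y))) hy)
  ... | a≡a' , b≡b' = cong₂ _,_ (toℕ-injective a≡a') (toℕ-injective b≡b')

  agree-twice : ∀ {L L' x y} → x < p → y < p → x ≢ y →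
    height L x ≡ height L' x → height L y ≡ height L' y → L ≡ L'
  agree-twice {x = x} {y} x<p y<p x≢y hx hy with <-cmp x y
  ... | tri< x<y _ _ = agree-ordered x<y y<p hx hy
  ... | tri≈ _ x≡y _ = ⊥-elim (x≢y x≡y)
  ... | tri> _ _ y<x = agree-ordered y<x x<p hy hx

  column-once : ∀ {L u v} → OnLine L u → OnLine L v → col u ≡ col v → u ≡ v
  column-once {L} lu lv c =
    position-injective c (trans (sym lu) (trans (cong (height L) c) lv))

  line-unique : ∀ {L L' u v} → u ≢ v →
    OnLine L u → OnLine L v → OnLine L' u → OnLine L' v → L ≡ L'
  line-unique {L} {L'} {u} {v} u≢v lu lv l'u l'v with col u ≟ col v
  ... | yes c = ⊥-elim (u≢v (column-once {L} lu lv c))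
  ... | no c = agree-twice (col<p u) (col<p v) c
                 (trans lu (sym l'u)) (trans lv (sym l'v))

  -- Two vertices in different columns lie on a common line: evaluation at
  -- their columns maps the M² lines injectively into the M² pairs of
  -- heights, hence onto them.
  line-through : ∀ {u v} → col u ≢ col v → ∃[ L ] (OnLine L u × OnLine L v)
  line-through {u} {v} c with
    injection-onto (≡-dec _≟_ _≟_) heights lines-unique enough
      (λ {L} _ → heights∈ L)
      (λ _ _ eq → agree-twice (col<p u) (col<p v) c (cong proj₁ eq) (cong proj₂ eq))
      (∈-cartesianProduct⁺ (∈-upTo⁺ (row<M u)) (∈-upTo⁺ (row<M v)))
    where
    heights : Line → ℕ × ℕ
    heights L = height L (col u) , height L (col v)
    targets : List (ℕ × ℕ)
    targets = cartesianProduct (upTo M) (upTo M)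
    enough : length targets ≤ length lines
    enough = ≤-reflexive (trans (length-upTo² M M) (sym #lines))
    heights∈ : ∀ L → heights L ∈ targets
    heights∈ (a , b) = ∈-cartesianProduct⁺ (∈-upTo⁺ (m%n<n (toℕ a + toℕ b * col u) M))
                                           (∈-upTo⁺ (m%n<n (toℕ a + toℕ b * col v) M))
  ... | L , _ , eq = L , cong proj₁ eq , cong proj₂ eq

-- Counting: at most M² good lines; at most e(F) bad lines, since an edge of F
-- lies on at most one line; an uncovered edge either joins two vertices of the
-- same column (at most n·M such edges) or lies on a bad line, which it meets
-- in a pair of columns (at most e(F)·p² such edges).
module Construction (n p m : ℕ) .{{_ : NonZero p}}
  (units : ∀ {d} → 0 Nat.< d → d Nat.< p → d ∣ m) (n≤pM : n Nat.≤ p Nat.* suc m)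
  (F : Graph n) where

  open import Data.Nat using (_+_; _*_; _<_; _≤_; _<ᵇ_; _<?_)
  open import Data.Nat.Properties
    using (<-cmp; <-asym; <-irrefl; <⇒<ᵇ; <ᵇ⇒<; ≤-trans; ≤-reflexive; +-mono-≤; +-monoʳ-≤; *-monoˡ-≤)
  open import Data.Bool using (Bool; true; false; T; _∧_)
  open import Data.Bool.Properties using (T-∧)
  open import Data.Fin using (Fin; toℕ; _≟_)
  open import Data.Fin.Properties using (toℕ-injective)
  open import Data.List using (List; length; map; _++_; concatMap; allFin; upTo; filter; filterᵇ; cartesianProduct)
  open import Data.List.Properties using (length-++; length-map; length-filter; length-upTo)
  open import Data.List.Relation.Unary.Any using (Any; any?) renaming (map to Any-map)
  open import Data.List.Relation.Unary.Unique.Propositional using (Unique)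
  import Data.List.Relation.Unary.Unique.Propositional.Properties as Unique
  open import Data.List.Membership.Propositional using (_∈_; find; lose)
  open import Data.List.Membership.Propositional.Properties
    using (∈-allFin; ∈-upTo⁺; ∈-cartesianProduct⁺; ∈-map⁺; ∈-map⁻; ∈-++⁺ˡ; ∈-++⁺ʳ; ∈-++⁻; ∈-filter⁺; ∈-filter⁻)
  open import Data.Product using (_×_; _,_; proj₁; proj₂; ∃-syntax)
  open import Data.Sum using (_⊎_; inj₁; inj₂)
  open import Data.Empty using (⊥; ⊥-elim)
  open import Function using (_∘_; Equivalence)
  open import Relation.Binary using (tri<; tri≈; tri>)
  open import Relation.Binary.PropositionalEquality
  open import Relation.Nullary using (¬_; yes; no; ¬?; _×-dec_; _⊎-dec_)
  open import Relation.Nullary.Decidable using (T?)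
  open import Relation.Unary using (Decidable)
  open Equivalence
  open Congruence m using (M)
  open Grid n p m units n≤pM
  open Counting
  open TaggedPartition using (adjacent⇒distinct; taggedPartition)

  Pair : Set
  Pair = Fin n × Fin n

  -- All ordered pairs of vertices, listed as in the definition of edgeCount.
  allPairs : List Pair
  allPairs = concatMap (λ u → map (λ v → (u , v)) (allFin n)) (allFin n)

  allPairs-unique : Unique allPairs
  allPairs-unique = subst Unique (sym (concatMap-pairs (allFin n) (allFin n)))
    (Unique.cartesianProduct⁺ (Unique.allFin⁺ n) (Unique.allFin⁺ n))

  ∈-allPairs : ∀ u v → (u , v) ∈ allPairs
  ∈-allPairs u v = subst ((u , v) ∈_) (sym (concatMap-pairs (allFin n) (allFin n)))
    (∈-cartesianProduct⁺ (∈-allFin u) (∈-allFin v))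

  isEdge : Pair → Bool
  isEdge (u , v) = (toℕ u <ᵇ toℕ v) ∧ Adj F u v

  complement-adj : ∀ {u v} → u ≢ v → ¬ T (Adj F u v) → T (compAdj F u v)
  complement-adj {u} {v} u≢v nadj with u ≟ v
  ... | yes u≡v = ⊥-elim (u≢v u≡v)
  ... | no _ with Adj F u v
  ...   | true = ⊥-elim (nadj _)
  ...   | false = _

  edge-listed : ∀ {u v} → u ≢ v → T (Adj F u v) → T (isEdge (u , v)) ⊎ T (isEdge (v , u))
  edge-listed {u} {v} u≢v adj with <-cmp (toℕ u) (toℕ v)
  ... | tri< u<v _ _ = inj₁ (from T-∧ (<⇒<ᵇ u<v , adj))
  ... | tri≈ _ u≡v _ = ⊥-elim (u≢v (toℕ-injective u≡v))
  ... | tri> _ _ v<u = inj₂ (from T-∧ (<⇒<ᵇ v<u , subst T (symm F u v) adj))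

  Contains : Line → Pair → Set
  Contains L (u , v) = OnLine L u × OnLine L v

  contains? : ∀ L → Decidable (Contains L)
  contains? L (u , v) = onLine? L u ×-dec onLine? L v

  Bad : Line → Set
  Bad L = Any (λ e → T (isEdge e) × Contains L e) allPairs

  bad? : Decidable Bad
  bad? L = any? (λ e → T? (isEdge e) ×-dec contains? L e) allPairs

  goodLines badLines : List Line
  goodLines = filter (¬? ∘ bad?) lines
  badLines = filter bad? lines

  good-clique : ∀ {L u v} → L ∈ goodLines → OnLine L u → OnLine L v → u ≢ v →
    T (compAdj F u v)
  good-clique {L} {u} {v} good lu lv u≢v = complement-adj u≢v λ adj →
    proj₂ (∈-filter⁻ (¬? ∘ bad?) good) (bad (edge-listed u≢v adj))
    where
    bad : T (isEdge (u , v)) ⊎ T (isEdge (v , u)) → Bad L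
    bad (inj₁ e) = lose (∈-allPairs u v) (e , lu , lv)
    bad (inj₂ e) = lose (∈-allPairs v u) (e , lv , lu)

  Covered : Pair → Set
  Covered e = Any (λ L → Contains L e) goodLines

  covered-swap : ∀ {u v} → Covered (u , v) → Covered (v , u)
  covered-swap = Any-map (λ (lu , lv) → lv , lu)

  Uncovered : Pair → Set
  Uncovered (u , v) = toℕ u < toℕ v × T (compAdj F u v) × ¬ Covered (u , v)

  uncovered? : Decidable Uncovered
  uncovered? (u , v) = toℕ u <? toℕ v ×-dec T? (compAdj F u v)
                       ×-dec ¬? (any? (λ L → contains? L (u , v)) goodLines)

  uncovered : List Pair
  uncovered = filter uncovered? allPairs

  uncovered-sound : ∀ {e} → e ∈ uncovered → Uncovered e
  uncovered-sound e∈ = proj₂ (∈-filter⁻ uncovered? {xs = allPairs} e∈)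

  Tag : Set
  Tag = Line ⊎ Pair

  Member : Tag → Fin n → Set
  Member (inj₁ L) w = OnLine L w
  Member (inj₂ (x , y)) w = w ≡ x ⊎ w ≡ y

  member? : ∀ t → Decidable (Member t)
  member? (inj₁ L) = onLine? L
  member? (inj₂ (x , y)) w = (w ≟ x) ⊎-dec (w ≟ y)

  tags : List Tag
  tags = map inj₁ goodLines ++ map inj₂ uncovered

  tag-cases : ∀ {t} → t ∈ tags →
    (∃[ L ] (L ∈ goodLines × t ≡ inj₁ L)) ⊎ (∃[ e ] (e ∈ uncovered × t ≡ inj₂ e))
  tag-cases t∈ with ∈-++⁻ (map inj₁ goodLines) t∈
  ... | inj₁ t∈₁ = inj₁ (∈-map⁻ inj₁ t∈₁)
  ... | inj₂ t∈₂ = inj₂ (∈-map⁻ inj₂ t∈₂)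

  tags-unique : Unique tags
  tags-unique = Unique.++⁺
    (Unique.map⁺ (λ { refl → refl }) (Unique.filter⁺ (¬? ∘ bad?) lines-unique))
    (Unique.map⁺ (λ { refl → refl }) (Unique.filter⁺ uncovered? allPairs-unique))
    λ (l∈ , e∈) → apart (∈-map⁻ inj₁ l∈) (∈-map⁻ inj₂ e∈)
    where
    apart : ∀ {t} → ∃[ L ] (L ∈ goodLines × t ≡ inj₁ L) → ∃[ e ] (e ∈ uncovered × t ≡ inj₂ e) →
      ⊥
    apart (_ , _ , refl) (_ , _ , ())

  pair-ends : ∀ {x y u v} → u ≢ v → Member (inj₂ (x , y)) u → Member (inj₂ (x , y)) v →
    (x ≡ u × y ≡ v) ⊎ (x ≡ v × y ≡ u)
  pair-ends u≢v (inj₁ refl) (inj₁ refl) = ⊥-elim (u≢v refl)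
  pair-ends u≢v (inj₁ refl) (inj₂ refl) = inj₁ (refl , refl)
  pair-ends u≢v (inj₂ refl) (inj₁ refl) = inj₂ (refl , refl)
  pair-ends u≢v (inj₂ refl) (inj₂ refl) = ⊥-elim (u≢v refl)

  tag-clique : ∀ {t u v} → t ∈ tags → Member t u → Member t v → u ≢ v → T (compAdj F u v)
  tag-clique t∈ mu mv u≢v with tag-cases t∈
  ... | inj₁ (L , good , refl) = good-clique good mu mv u≢v
  ... | inj₂ ((x , y) , e∈ , refl) with pair-ends u≢v mu mv | proj₁ (proj₂ (uncovered-sound e∈))
  ...   | inj₁ (refl , refl) | adj = adj
  ...   | inj₂ (refl , refl) | adj = subst T (compSym F x y) adj

  pair∈ : ∀ {e} → e ∈ uncovered → inj₂ e ∈ tags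
  pair∈ e∈ = ∈-++⁺ʳ (map inj₁ goodLines) (∈-map⁺ inj₂ e∈)

  tag-cover : ∀ {u v} → T (compAdj F u v) → ∃[ t ] (t ∈ tags × Member t u × Member t v)
  tag-cover {u} {v} adj with any? (λ L → contains? L (u , v)) goodLines
  ... | yes covered with find covered
  ...   | L , good , lu , lv = inj₁ L , ∈-++⁺ˡ (∈-map⁺ inj₁ good) , lu , lv
  tag-cover {u} {v} adj | no uncov with <-cmp (toℕ u) (toℕ v)
  ... | tri< u<v _ _ = inj₂ (u , v) , pair∈ (∈-filter⁺ uncovered? (∈-allPairs u v) (u<v , adj , uncov)) ,
                         inj₁ refl , inj₂ refl
  ... | tri≈ _ u≡v _ = ⊥-elim (adjacent⇒distinct (complement F) adj (toℕ-injective u≡v))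
  ... | tri> _ _ v<u = inj₂ (v , u) ,
                         pair∈ (∈-filter⁺ uncovered? (∈-allPairs v u)
                                  (v<u , subst T (compSym F u v) adj , uncov ∘ covered-swap)) ,
                         inj₂ refl , inj₁ refl

  line-pair-apart : ∀ {L e u v} → L ∈ goodLines → e ∈ uncovered → u ≢ v →
    OnLine L u → OnLine L v → Member (inj₂ e) u → Member (inj₂ e) v → ⊥
  line-pair-apart {L} {x , y} good e∈ u≢v lu lv mu mv
    with pair-ends u≢v mu mv | proj₂ (proj₂ (uncovered-sound e∈))
  ... | inj₁ (refl , refl) | uncov = uncov (lose good (lu , lv))
  ... | inj₂ (refl , refl) | uncov = uncov (lose good (lv , lu))

  -- Two uncovered edges through the same two vertices are the same edge,
  -- since both list the smaller end first.
  pairs-agree : ∀ {e e' u v} → e ∈ uncovered → e' ∈ uncovered → u ≢ v →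
    Member (inj₂ e) u → Member (inj₂ e) v → Member (inj₂ e') u → Member (inj₂ e') v → e ≡ e'
  pairs-agree {x , y} {x' , y'} e∈ e'∈ u≢v mu mv mu' mv'
    with pair-ends u≢v mu mv | pair-ends u≢v mu' mv'
       | proj₁ (uncovered-sound e∈) | proj₁ (uncovered-sound e'∈)
  ... | inj₁ (refl , refl) | inj₁ (refl , refl) | _ | _ = refl
  ... | inj₂ (refl , refl) | inj₂ (refl , refl) | _ | _ = refl
  ... | inj₁ (refl , refl) | inj₂ (refl , refl) | x<y | y<x = ⊥-elim (<-asym x<y y<x)
  ... | inj₂ (refl , refl) | inj₁ (refl , refl) | x<y | y<x = ⊥-elim (<-asym x<y y<x)

  tag-once : ∀ {t t' u v} → t ∈ tags → t' ∈ tags → u ≢ v →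
    Member t u → Member t v → Member t' u → Member t' v → t ≡ t'
  tag-once t∈ t'∈ u≢v mu mv mu' mv' with tag-cases t∈ | tag-cases t'∈
  ... | inj₁ (L , _ , refl) | inj₁ (L' , _ , refl) = cong inj₁ (line-unique {L} u≢v mu mv mu' mv')
  ... | inj₁ (L , good , refl) | inj₂ (e , e∈ , refl) =
        ⊥-elim (line-pair-apart {L} good e∈ u≢v mu mv mu' mv')
  ... | inj₂ (e , e∈ , refl) | inj₁ (L , good , refl) =
        ⊥-elim (line-pair-apart {L} good e∈ u≢v mu' mv' mu mv)
  ... | inj₂ (e , e∈ , refl) | inj₂ (e' , e'∈ , refl) =
        cong inj₂ (pairs-agree e∈ e'∈ u≢v mu mv mu' mv')

  partition : CliquePartition (complement F) (length tags)
  partition = taggedPartition (complement F) Member member? tags tags-unique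
    tag-clique tag-cover tag-once

  #good : length goodLines ≤ M * M
  #good = ≤-trans (length-filter (¬? ∘ bad?) lines) (≤-reflexive #lines)

  -- Bad lines are at most as many as edges of F: map each bad line to an
  -- edge of F on it; an edge lies on only one line.
  #bad : length badLines ≤ edgeCount F
  #bad = injection-≤ (λ L e → T (isEdge e) × Contains L e)
    (Unique.filter⁺ bad? lines-unique) witness same-line
    where
    witness : ∀ {L} → L ∈ badLines →
      ∃[ e ] (e ∈ filterᵇ isEdge allPairs × T (isEdge e) × Contains L e)
    witness L∈ with find (proj₂ (∈-filter⁻ bad? {xs = lines} L∈))
    ... | e , e∈ , edge , on = e , ∈-filter⁺ (T? ∘ isEdge) e∈ edge , edge , on
    same-line : ∀ {L L' e} → L ∈ badLines → L' ∈ badLines →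
      T (isEdge e) × Contains L e → T (isEdge e) × Contains L' e → L ≡ L'
    same-line {L} {e = u , v} _ _ (edge , lu , lv) (_ , l'u , l'v) =
      line-unique {L} u≢v lu lv l'u l'v
      where
      u≢v : u ≢ v
      u≢v refl = <-irrefl refl (<ᵇ⇒< (toℕ u) (toℕ u) (proj₁ (to T-∧ edge)))

  -- Targets for counting uncovered edges: an edge inside a column is recorded
  -- by its first end and the row of its second end; any other uncovered edge
  -- by the (necessarily bad) line through it and the columns of its ends.
  Target : Set
  Target = (Fin n × ℕ) ⊎ (Line × (ℕ × ℕ))

  sameColumn : List (Fin n × ℕ)
  sameColumn = cartesianProduct (allFin n) (upTo M)

  onBadLine : List (Line × (ℕ × ℕ))
  onBadLine = cartesianProduct badLines (cartesianProduct (upTo p) (upTo p))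

  targets : List Target
  targets = map inj₁ sameColumn ++ map inj₂ onBadLine

  Records : Pair → Target → Set
  Records (u , v) (inj₁ (w , r)) = col u ≡ col v × w ≡ u × row v ≡ r
  Records (u , v) (inj₂ (L , x , y)) = Contains L (u , v) × col u ≡ x × col v ≡ y

  uncovered-on-bad : ∀ {L u v} → (u , v) ∈ uncovered → Contains L (u , v) → L ∈ badLines
  uncovered-on-bad {L} e∈ on with bad? L
  ... | yes bad = ∈-filter⁺ bad? (∈-lines L) bad
  ... | no good = ⊥-elim (proj₂ (proj₂ (uncovered-sound e∈))
                            (lose (∈-filter⁺ (¬? ∘ bad?) (∈-lines L) good) on))

  record-uncovered : ∀ {e} → e ∈ uncovered → ∃[ t ] (t ∈ targets × Records e t)
  record-uncovered {u , v} e∈ with col u Nat.≟ col v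
  ... | yes c = inj₁ (u , row v) ,
        ∈-++⁺ˡ (∈-map⁺ inj₁ (∈-cartesianProduct⁺ (∈-allFin u) (∈-upTo⁺ (row<M v)))) ,
        c , refl , refl
  ... | no c with line-through c
  ...   | L , on = inj₂ (L , col u , col v) ,
          ∈-++⁺ʳ (map inj₁ sameColumn)
            (∈-map⁺ inj₂ (∈-cartesianProduct⁺ (uncovered-on-bad e∈ on)
              (∈-cartesianProduct⁺ (∈-upTo⁺ (col<p u)) (∈-upTo⁺ (col<p v))))) ,
          on , refl , refl

  records-injective : ∀ {e e' t} → Records e t → Records e' t → e ≡ e'
  records-injective {u , v} {u' , v'} {inj₁ _} (c , refl , r) (c' , refl , r') =
    cong (u ,_) (position-injective (trans (sym c) c') (trans r (sym r')))
  records-injective {u , v} {u' , v'} {inj₂ (L , _)} ((lu , lv) , x , y) ((lu' , lv') , x' , y') =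
    cong₂ _,_ (column-once {L} lu lu' (trans x (sym x'))) (column-once {L} lv lv' (trans y (sym y')))

  #targets : length targets ≡ n * M + length badLines * (p * p)
  #targets = begin
    length targets                                     ≡⟨ length-++ (map inj₁ sameColumn) ⟩
    length (map inj₁ sameColumn) + length (map inj₂ onBadLine)
                                                       ≡⟨ cong₂ _+_ (length-map inj₁ sameColumn) (length-map inj₂ onBadLine) ⟩
    length sameColumn + length onBadLine               ≡⟨ cong₂ _+_ #sameColumn #onBadLine ⟩
    n * M + length badLines * (p * p)                  ∎
    where
    open ≡-Reasoning
    #sameColumn : length sameColumn ≡ n * M
    #sameColumn = trans (length-cartesianProduct (allFin n) (upTo M))
                        (cong₂ _*_ (length-allFin n) (length-upTo M))
    #onBadLine : length onBadLine ≡ length badLines * (p * p)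
    #onBadLine = trans (length-cartesianProduct badLines (cartesianProduct (upTo p) (upTo p)))
                       (cong (length badLines *_) (length-upTo² p p))

  #uncovered : length uncovered ≤ n * M + length badLines * (p * p)
  #uncovered = ≤-trans
    (injection-≤ Records (Unique.filter⁺ uncovered? allPairs-unique) record-uncovered
      (λ _ _ → records-injective))
    (≤-reflexive #targets)

  #tags : length tags ≤ M * M + (n * M + edgeCount F * (p * p))
  #tags = begin
    length tags                                   ≡⟨ length-++ (map inj₁ goodLines) ⟩
    length (map inj₁ goodLines) + length (map inj₂ uncovered)
                                                  ≡⟨ cong₂ _+_ (length-map inj₁ goodLines) (length-map inj₂ uncovered) ⟩
    length goodLines + length uncovered           ≤⟨ +-mono-≤ #good #uncovered ⟩
    M * M + (n * M + length badLines * (p * p))   ≤⟨ +-monoʳ-≤ (M * M) (+-monoʳ-≤ (n * M) (*-monoˡ-≤ (p * p) #bad)) ⟩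
    M * M + (n * M + edgeCount F * (p * p))       ∎
    where open Data.Nat.Properties.≤-Reasoning

-- For p columns and any L > 0 take m = (⌊n/(pL)⌋ + 1)·L:
-- a multiple of L (used with L = p!, so that every 0 < d < p divides m) for
-- which the grid [0,p) × [0,1+m) has room for n vertices but, once
-- n ≥ p(L + 1), at most 2n points.
module Dimensions (n p L : ℕ) .{{_ : NonZero p}} .{{_ : NonZero L}} where

  open import Data.Nat using (_+_; _*_; _≤_; _/_; _%_)
  open import Data.Nat.Properties
    using (*-distribˡ-+; *-identityʳ; +-comm; m≤m+n; m*n≢0; <⇒≤; +-monoˡ-≤; +-monoʳ-≤; +-mono-≤; ≤-reflexive)
  open import Data.Nat.DivMod using (m%n<n; m≡m%n+[m/n]*n; m/n*n≤m)
  open import Data.Nat.Divisibility using (n∣m*n)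
  open import Data.Nat.Tactic.RingSolver using (solve-∀)
  open import Relation.Binary.PropositionalEquality
  open Data.Nat.Properties.≤-Reasoning

  instance
    pL≢0 : NonZero (p * L)
    pL≢0 = m*n≢0 p L

  q : ℕ
  q = n / (p * L)

  m : ℕ
  m = (q + 1) * L

  L∣m : L ∣ m
  L∣m = n∣m*n (q + 1)

  grid-size : p * suc m ≡ q * (p * L) + (p * L + p)
  grid-size = identity p q L
    where
    identity : ∀ p q L → p * suc ((q + 1) * L) ≡ q * (p * L) + (p * L + p)
    identity = solve-∀

  n≤pM : n ≤ p * suc m
  n≤pM = begin
    n                          ≡⟨ m≡m%n+[m/n]*n n (p * L) ⟩
    n % (p * L) + q * (p * L)  ≤⟨ +-monoˡ-≤ (q * (p * L)) (<⇒≤ (m%n<n n (p * L))) ⟩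
    p * L + q * (p * L)        ≡⟨ +-comm (p * L) (q * (p * L)) ⟩
    q * (p * L) + p * L        ≤⟨ +-monoʳ-≤ (q * (p * L)) (m≤m+n (p * L) p) ⟩
    q * (p * L) + (p * L + p)  ≡⟨ grid-size ⟨
    p * suc m                  ∎

  pM≤2n : p * (L + 1) ≤ n → p * suc m ≤ n + n
  pM≤2n large = begin
    p * suc m                  ≡⟨ grid-size ⟩
    q * (p * L) + (p * L + p)  ≤⟨ +-mono-≤ (m/n*n≤m n (p * L)) (≤-reflexive p*[L+1]) ⟩
    n + p * (L + 1)            ≤⟨ +-monoʳ-≤ n large ⟩
    n + n                      ∎
    where
    p*[L+1] : p * L + p ≡ p * (L + 1)
    p*[L+1] = sym (trans (*-distribˡ-+ p L 1) (cong (p * L +_) (*-identityʳ p)))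

∣-factorial : ∀ {d k} → 0 Nat.< d → d Nat.≤ k → d ∣ k Nat.!
∣-factorial {suc d} _ d≤k = ∣-trans (m∣m*n (d Nat.!)) (m≤n⇒m!∣n! d≤k)

module RationalScaling where

  open import Data.Nat using (_*_) renaming (_≤_ to _≤ℕ_)
  import Data.Nat.Properties as ℕP
  open import Data.Integer as ℤ using (+_; +≤+)
  import Data.Integer.Properties as ℤP
  open import Data.Rational using (ℚ; mkℚ; _≤_; _/_; toℚᵘ) renaming (_*_ to _*ℚ_)
  open import Data.Rational.Properties
    using (normalize-coprime; toℚᵘ-mono-≤; toℚᵘ-cancel-≤; toℚᵘ-homo-*; toℚᵘ-cong)
  open import Data.Rational.Unnormalised as ℚᵘ using (mkℚᵘ; *≤*)
  import Data.Rational.Unnormalised.Properties as ℚᵘP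
  open import Data.Nat.Coprimality using (Coprime; 1-coprimeTo) renaming (sym to coprime-sym)
  open import Function using (_⇔_; mk⇔)
  open import Relation.Binary.PropositionalEquality

  ⟦_⟧ : ℕ → ℚ
  ⟦ k ⟧ = + k / 1

  ⟦⟧-unnormalised : ∀ k → toℚᵘ ⟦ k ⟧ ℚᵘ.≃ mkℚᵘ (+ k) 0
  ⟦⟧-unnormalised k = toℚᵘ-cong (normalize-coprime (coprime-sym (1-coprimeTo k)))

  pos-* : ∀ u v → + u ℤ.* + v ≡ + (u * v)
  pos-* u v = sym (ℤP.pos-* u v)

  module _ (a b : ℕ) .(c : Coprime a (suc b)) (k n : ℕ) where

    bound : ℚ
    bound = mkℚ (+ a) b c *ℚ (⟦ n ⟧ *ℚ ⟦ n ⟧)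

    bound-unnormalised : toℚᵘ bound ℚᵘ.≃ mkℚᵘ (+ a) b ℚᵘ.* (mkℚᵘ (+ n) 0 ℚᵘ.* mkℚᵘ (+ n) 0)
    bound-unnormalised = ℚᵘP.≃-trans (toℚᵘ-homo-* (mkℚ (+ a) b c) (⟦ n ⟧ *ℚ ⟦ n ⟧))
      (ℚᵘP.*-cong (ℚᵘP.≃-refl {toℚᵘ (mkℚ (+ a) b c)})
        (ℚᵘP.≃-trans (toℚᵘ-homo-* ⟦ n ⟧ ⟦ n ⟧) (ℚᵘP.*-cong (⟦⟧-unnormalised n) (⟦⟧-unnormalised n))))

    lhs : + k ℤ.* + suc (b * 1) ≡ + (k * suc (b * 1))
    lhs = pos-* k (suc (b * 1))

    rhs : (+ a ℤ.* (+ n ℤ.* + n)) ℤ.* + 1 ≡ + (a * (n * n))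
    rhs = trans (ℤP.*-identityʳ _) (trans (cong (+ a ℤ.*_) (pos-* n n)) (pos-* a (n * n)))

    denominator : k * suc (b * 1) ≡ k * suc b
    denominator = cong (λ d → k * suc d) (ℕP.*-identityʳ b)

    scaling : ⟦ k ⟧ ≤ bound ⇔ k * suc b ≤ℕ a * (n * n)
    scaling = mk⇔ to from
      where
      to : ⟦ k ⟧ ≤ bound → k * suc b ≤ℕ a * (n * n)
      to k≤ with ℚᵘP.≤-respʳ-≃ bound-unnormalised (ℚᵘP.≤-respˡ-≃ (⟦⟧-unnormalised k) (toℚᵘ-mono-≤ k≤))
      ... | *≤* cross = subst (_≤ℕ a * (n * n)) denominator (ℤP.drop‿+≤+ (subst₂ ℤ._≤_ lhs rhs cross))
      from : k * suc b ≤ℕ a * (n * n) → ⟦ k ⟧ ≤ bound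
      from k≤ = toℚᵘ-cancel-≤ (ℚᵘP.≤-respˡ-≃ (ℚᵘP.≃-sym (⟦⟧-unnormalised k))
        (ℚᵘP.≤-respʳ-≃ (ℚᵘP.≃-sym bound-unnormalised)
          (*≤* (subst₂ ℤ._≤_ (sym lhs) (sym rhs) (+≤+ (subst (_≤ℕ a * (n * n)) (sym denominator) k≤))))))

-- With p = 8D columns, a grid of pM ≤ 2n points, and
-- e ≤ n²/(4Dp²) edges of F, the partition size M² + nM + e·p² is at most n²/D:
-- the three terms contribute at most n²/(16D), 4n²/(16D) and 4n²/(16D).
module Estimate where

  open import Data.Nat using (_+_; _*_; _≤_)
  open import Data.Nat.Properties
    using (*-cancelˡ-≤; *-monoʳ-≤; *-monoˡ-≤; *-mono-≤; +-mono-≤; m≤m*n; m≤m+n)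
  open import Data.Nat.Tactic.RingSolver using (solve-∀)
  open import Relation.Binary.PropositionalEquality using (_≡_; subst; sym)
  open Data.Nat.Properties.≤-Reasoning

  double-square : ∀ n → (n + n) * (n + n) ≡ 4 * (n * n)
  double-square = solve-∀

  nine≤sixteen : ∀ x → x + (4 * x + 4 * x) ≤ 16 * x
  nine≤sixteen x = subst (_≤ 16 * x) (nine x) (subst (9 * x ≤_) (sym (sixteen x)) (m≤m+n (9 * x) (7 * x)))
    where
    nine : ∀ x → 9 * x ≡ x + (4 * x + 4 * x)
    nine = solve-∀
    sixteen : ∀ x → 16 * x ≡ 9 * x + 7 * x
    sixteen = solve-∀

  partition-estimate : ∀ D M n e k .{{_ : NonZero D}} → let p = 8 * D in
    p * M ≤ n + n → e * (4 * D * (p * p)) ≤ n * n →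
    k ≤ M * M + (n * M + e * (p * p)) → k * D ≤ n * n
  partition-estimate D M n e k grid sparse k≤ = *-cancelˡ-≤ 16 (begin
    16 * (k * D)                                       ≤⟨ *-monoʳ-≤ 16 (*-monoˡ-≤ D k≤) ⟩
    16 * ((M * M + (n * M + e * (p * p))) * D)         ≡⟨ split D M n e p ⟩
    16 * (D * (M * M)) + (16 * (D * (n * M)) + 16 * (D * (e * (p * p))))
                                                       ≤⟨ +-mono-≤ squares (+-mono-≤ columns bad) ⟩
    n * n + (4 * (n * n) + 4 * (n * n))                ≤⟨ nine≤sixteen (n * n) ⟩
    16 * (n * n)                                       ∎)
    where
    p = 8 * D
    split : ∀ D M n e p → 16 * ((M * M + (n * M + e * (p * p))) * D)
      ≡ 16 * (D * (M * M)) + (16 * (D * (n * M)) + 16 * (D * (e * (p * p))))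
    split = solve-∀
    squares : 16 * (D * (M * M)) ≤ n * n
    squares = *-cancelˡ-≤ 4 (begin
      4 * (16 * (D * (M * M)))       ≤⟨ *-monoʳ-≤ 4 (*-monoʳ-≤ 16 (*-monoˡ-≤ (M * M) (m≤m*n D D))) ⟩
      4 * (16 * (D * D * (M * M)))   ≡⟨ expand D M ⟩
      (p * M) * (p * M)              ≤⟨ *-mono-≤ grid grid ⟩
      (n + n) * (n + n)              ≡⟨ double-square n ⟩
      4 * (n * n)                    ∎)
      where
      expand : ∀ D M → 4 * (16 * (D * D * (M * M))) ≡ (8 * D * M) * (8 * D * M)
      expand = solve-∀
    columns : 16 * (D * (n * M)) ≤ 4 * (n * n)
    columns = begin
      16 * (D * (n * M))  ≡⟨ rearrange D n M ⟩
      (n + n) * (p * M)   ≤⟨ *-monoʳ-≤ (n + n) grid ⟩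
      (n + n) * (n + n)   ≡⟨ double-square n ⟩
      4 * (n * n)         ∎
      where
      rearrange : ∀ D n M → 16 * (D * (n * M)) ≡ (n + n) * (8 * D * M)
      rearrange = solve-∀
    bad : 16 * (D * (e * (p * p))) ≤ 4 * (n * n)
    bad = begin
      16 * (D * (e * (p * p)))        ≡⟨ rearrange D e p ⟩
      4 * (e * (4 * D * (p * p)))     ≤⟨ *-monoʳ-≤ 4 sparse ⟩
      4 * (n * n)                     ∎
      where
      rearrange : ∀ D e p → 16 * (D * (e * (p * p))) ≡ 4 * (e * (4 * D * (p * p)))
      rearrange = solve-∀

open import Data.Integer using (+_; -[1+_]; Positive)
open import Data.Rational using (ℚ; mkℚ; 0ℚ; _<_; _≤_; _*_; _/_; positive)
open import Data.Rational.Properties using (positive⁻¹)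
open import Data.Nat.Coprimality using (1-coprimeTo)
open import Data.Nat.Properties using (≤-trans; <⇒≤; m≤m+n; *-identityˡ; _!≢0)
open import Data.Product using (_×_; _,_; ∃-syntax)
open import Data.Empty using (⊥-elim)
open import Function using (Equivalence)
open import Relation.Binary.PropositionalEquality using (subst)
open Equivalence using (to; from)
open RationalScaling using (scaling)
open Estimate using (partition-estimate)

corollary6p3 : (ε : ℚ) → 0ℚ < ε →
    ∃[ η ] (0ℚ < η × ∃[ n₀ ] (∀ (n : ℕ) → n ≥ n₀ → (F : Graph n) →
      (+ edgeCount F / 1) ≤ η * ((+ n / 1) * (+ n / 1)) →
      ∀ (k : ℕ) → IsCP (complement F) k → (+ k / 1) ≤ ε * ((+ n / 1) * (+ n / 1))))
corollary6p3 (mkℚ (+ zero) b c) ε>0 = ⊥-elim (Positive.pos (positive ε>0))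
corollary6p3 (mkℚ -[1+ s ] b c) ε>0 = ⊥-elim (Positive.pos (positive ε>0))
corollary6p3 (mkℚ (+ suc s) b c) _ = η , positive⁻¹ η , n₀ , small-partition
  where
  -- ε = (1+s)/D ≥ 1/D; use p = 8D columns, moduli divisible by L = p!,
  -- η = 1/H with H = 4Dp², and n₀ = p(L + 1).
  D p L H : ℕ
  D = suc b
  p = 8 Nat.* D
  L = p Nat.!
  H = 4 Nat.* D Nat.* (p Nat.* p)
  η : ℚ
  η = mkℚ (+ 1) (Nat.pred H) (1-coprimeTo (suc (Nat.pred H)))
  n₀ : ℕ
  n₀ = p Nat.* (L Nat.+ 1)
  small-partition : ∀ n → n ≥ n₀ → (F : Graph n) →
    (+ edgeCount F / 1) ≤ η * ((+ n / 1) * (+ n / 1)) →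
    ∀ k → IsCP (complement F) k → (+ k / 1) ≤ mkℚ (+ suc s) b c * ((+ n / 1) * (+ n / 1))
  small-partition n n≥n₀ F sparse k (_ , minimal) =
    from (scaling (suc s) b c k n) (≤-trans kD≤n² (m≤m+n (n Nat.* n) (s Nat.* (n Nat.* n))))
    where
    instance
      L≢0 : NonZero L
      L≢0 = p !≢0
    open Dimensions n p L
    open Construction n p m (λ 0<d d<p → ∣-trans (∣-factorial 0<d (<⇒≤ d<p)) L∣m) n≤pM F
    few-edges : edgeCount F Nat.* H Nat.≤ n Nat.* n
    few-edges = subst (edgeCount F Nat.* H Nat.≤_) (*-identityˡ (n Nat.* n))
      (to (scaling 1 (Nat.pred H) _ (edgeCount F) n) sparse)
    kD≤n² : k Nat.* D Nat.≤ n Nat.* n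
    kD≤n² = partition-estimate D (suc m) n (edgeCount F) k (pM≤2n n≥n₀) few-edges
      (≤-trans (minimal _ partition) #tags)
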